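{- Let $T=(V,E)$ be a path and let $F\subseteq\binom{V}{2}\setminus E$. Then the hypergraph $H=(E,\{E_{uv}: uv\in F\})$ (which represents the corresponding path partition problem) is $\beta$-acyclic.
   Context: For distinct $u,v\in V$, $E_{uv}$ denotes the edge set of the unique $uv$-path in $T$. A hypergraph $H=(\bar V,\bar E)$ has node set $\bar V$ and a set $\bar E$ of subsets of $\bar V$ as edges. A $\beta$-cycle in $H$ is a sequence $(x_1,e_1,x_2,e_2,\dots,x_k,e_k)$ with $k\ge 3$, pairwise distinct nodes $x_1,\dots,x_k$ and pairwise distinct edges $e_1,\dots,e_k$, such that for each $i$ (indices mod $k$) the node $x_i$ belongs to $e_{i-1}$ and $e_i$ and to no other edge $e_j$ of the sequence. $H$ is $\beta$-acyclic if it contains no $\beta$-cycle. The path partition problem for $T$ and $F$ is the minimization over $z\in\{0,1\}^E$ of a multilinear function whose monomials are $\prod_{e\in E_{uv}}z_e$ for $uv\in E\cup F$, so its nonlinear monomials correspond to the edges of $H$. -}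

module Defs where

open import Data.Nat using (ℕ; zero; suc; _+_; _≤ᵇ_)
open import Data.Bool using (Bool; _∧_; _∨_)
open import Data.Fin using (Fin; zero; suc; toℕ; fromℕ; inject₁)
open import Data.Fin.Subset using (Subset; _∈_)
open import Data.Vec using (tabulate)
open import Data.Product using (Σ; ∃; _×_)
open import Data.Sum using (_⊎_)
open import Function.Definitions using (Injective)
open import Relation.Binary.PropositionalEquality using (_≡_; _≢_)
open import Relation.Nullary using (¬_)

record Hypergraph (N : ℕ) : Set₁ where
  field
    IsEdge : Subset N → Set
open Hypergraph public

cprev : ∀ {k} → Fin (suc k) → Fin (suc k)
cprev {k} zero    = fromℕ k
cprev     (suc i) = inject₁ i

-- A β-cycle (x₁,e₁,…,x_k,e_k) with k = 3 + k' ≥ 3, indices in Fin k (mod k):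
-- pairwise distinct nodes, pairwise distinct edges of H, x_i ∈ e_{i-1}, x_i ∈ e_i,
-- and x_i belongs to no other e_j of the sequence.
record BetaCycle {N : ℕ} (H : Hypergraph N) : Set where
  field
    k'      : ℕ
    x       : Fin (3 + k') → Fin N
    e       : Fin (3 + k') → Subset N
    edge    : ∀ i → IsEdge H (e i)
    x-inj   : Injective _≡_ _≡_ x
    e-inj   : Injective _≡_ _≡_ e
    in-prev : ∀ i → x i ∈ e (cprev i)
    in-cur  : ∀ i → x i ∈ e i
    only    : ∀ i j → x i ∈ e j → j ≡ i ⊎ j ≡ cprev i

BetaAcyclic : ∀ {N} → Hypergraph N → Set
BetaAcyclic H = ¬ BetaCycle H

-- The path T = (V,E) with V = Fin (suc m) (vertices 0,…,m) and edge set
-- E = Fin m, where edge i joins vertices i and i+1.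
Adjacent : ∀ {m} → Fin (suc m) → Fin (suc m) → Set
Adjacent u v = toℕ v ≡ suc (toℕ u) ⊎ toℕ u ≡ suc (toℕ v)

-- E_uv : edge set of the unique uv-path in T, i.e. the edges i with
-- min(u,v) ≤ i < max(u,v).
pathEdges : ∀ {m} → Fin (suc m) → Fin (suc m) → Subset m
pathEdges u v = tabulate λ i →
  ((toℕ u ≤ᵇ toℕ i) ∧ (suc (toℕ i) ≤ᵇ toℕ v)) ∨
  ((toℕ v ≤ᵇ toℕ i) ∧ (suc (toℕ i) ≤ᵇ toℕ u))

-- H = (E, { E_uv : uv ∈ F }), with F given as a relation on vertices
-- (the unordered pair uv ∈ F iff F u v or F v u).
pathHypergraph : (m : ℕ) → (Fin (suc m) → Fin (suc m) → Set) → Hypergraph m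
pathHypergraph m F = record
  { IsEdge = λ S → Σ (Fin (suc m)) λ u → Σ (Fin (suc m)) λ v → F u v × S ≡ pathEdges u v }

{-# OPTIONS --safe #-}
module Submission where

open import Defs
open import Data.Nat using (ℕ; zero; suc; _≤_; _<_)
open import Data.Nat.Properties
  using (≤-refl; ≤-trans; ≤-total; ≤-<-trans; <-≤-trans; <-trans; <-irrefl; 1+n≢n; ≤ᵇ⇒≤; ≤⇒≤ᵇ)
open import Data.Fin using (Fin; zero; suc; toℕ; inject₁)
open import Data.Fin.Properties using (toℕ-inject₁)
open import Data.Fin.Subset using (Subset; _∈_)
open import Data.Vec.Properties using (lookup∘tabulate; []=⇒lookup; lookup⇒[]=)
open import Data.Bool.Properties using (T-≡; T-∧; T-∨)
open import Data.Product as Prod using (∃; _×_; _,_)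
open import Data.Sum as Sum using (_⊎_; inj₁; inj₂; [_,_])
open import Data.Empty using (⊥-elim)
open import Function using (_∘_)
open import Function.Bundles using (Equivalence)
open import Relation.Binary.PropositionalEquality
  using (_≡_; _≢_; refl; sym; trans; cong; module ≡-Reasoning)
open import Relation.Nullary using (¬_)

open Equivalence using (to; from)

-- The edges E_uv of a path are intervals of E. In a β-cycle let x_p be the
-- leftmost node and x_a, x_b its cycle neighbours, with x_p, x_a ∈ e_a and
-- x_p, x_b ∈ e_p. Both neighbours lie right of x_p, so the nearer one lies
-- between x_p and the farther one, hence in the interval the farther one
-- shares with x_p: a node of the cycle in an edge not incident to it in the
-- cycle.

OnPath : ℕ → ℕ → ℕ → Set
OnPath u v i = (u ≤ i × i < v) ⊎ (v ≤ i × i < u)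

OnPath-convex : ∀ {u v i j l} → i ≤ j → j ≤ l → OnPath u v i → OnPath u v l → OnPath u v j
OnPath-convex i≤j j≤l (inj₁ (u≤i , _)) (inj₁ (_ , l<v)) = inj₁ (≤-trans u≤i i≤j , ≤-<-trans j≤l l<v)
OnPath-convex i≤j j≤l (inj₂ (v≤i , _)) (inj₂ (_ , l<u)) = inj₂ (≤-trans v≤i i≤j , ≤-<-trans j≤l l<u)
OnPath-convex _ _ (inj₁ (u≤i , i<v)) (inj₂ (v≤l , l<u)) =
  ⊥-elim (<-irrefl refl (≤-<-trans u≤i (<-trans (<-≤-trans i<v v≤l) l<u)))
OnPath-convex _ _ (inj₂ (v≤i , i<u)) (inj₁ (u≤l , l<v)) =
  ⊥-elim (<-irrefl refl (≤-<-trans v≤i (<-trans (<-≤-trans i<u u≤l) l<v)))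

module _ {m : ℕ} (u v : Fin (suc m)) (i : Fin m) where

  ∈-pathEdges⁻ : i ∈ pathEdges u v → OnPath (toℕ u) (toℕ v) (toℕ i)
  ∈-pathEdges⁻ i∈ =
    Sum.map (Prod.map (≤ᵇ⇒≤ _ _) (≤ᵇ⇒≤ _ _) ∘ to T-∧)
            (Prod.map (≤ᵇ⇒≤ _ _) (≤ᵇ⇒≤ _ _) ∘ to T-∧)
            (to T-∨ (from T-≡ (trans (sym (lookup∘tabulate _ i)) ([]=⇒lookup i∈))))

  ∈-pathEdges⁺ : OnPath (toℕ u) (toℕ v) (toℕ i) → i ∈ pathEdges u v
  ∈-pathEdges⁺ onPath =
    lookup⇒[]= i _ (trans (lookup∘tabulate _ i) (to T-≡ (from T-∨
      (Sum.map (from T-∧ ∘ Prod.map ≤⇒≤ᵇ ≤⇒≤ᵇ) (from T-∧ ∘ Prod.map ≤⇒≤ᵇ ≤⇒≤ᵇ) onPath))))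

OrderConvex : ∀ {m} → Subset m → Set
OrderConvex S = ∀ {i j l} → toℕ i ≤ toℕ j → toℕ j ≤ toℕ l → i ∈ S → l ∈ S → j ∈ S

pathEdges-orderConvex : ∀ {m} (u v : Fin (suc m)) → OrderConvex (pathEdges u v)
pathEdges-orderConvex u v i≤j j≤l i∈ l∈ =
  ∈-pathEdges⁺ u v _ (OnPath-convex i≤j j≤l (∈-pathEdges⁻ u v _ i∈) (∈-pathEdges⁻ u v _ l∈))

∃-argmin : ∀ {n} (f : Fin (suc n) → ℕ) → ∃ λ p → ∀ j → f p ≤ f j
∃-argmin {zero} f = zero , λ { zero → ≤-refl }
∃-argmin {suc n}  f with ∃-argmin (f ∘ suc)
... | q , fq-min with ≤-total (f zero) (f (suc q))
...   | inj₁ f0≤fq = zero  , λ { zero → ≤-refl ; (suc j) → ≤-trans f0≤fq (fq-min j) }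
...   | inj₂ fq≤f0 = suc q , λ { zero → fq≤f0  ; (suc j) → fq-min j }

cprev-surjective : ∀ {k} (i : Fin (suc k)) → ∃ λ j → cprev j ≡ i
cprev-surjective {zero} zero = zero , refl
cprev-surjective {suc k}  zero = suc zero , refl
cprev-surjective {suc k}  (suc i) with cprev-surjective i
... | zero  , refl = zero , refl
... | suc j , refl = suc (suc j) , refl

cprev-irreflexive : ∀ {k} (i : Fin (suc (suc k))) → cprev i ≢ i
cprev-irreflexive zero    ()
cprev-irreflexive (suc i) eq = 1+n≢n (sym (trans (sym (toℕ-inject₁ i)) (cong toℕ eq)))

cprev²-irreflexive : ∀ {k} (i : Fin (suc (suc (suc k)))) → cprev (cprev i) ≢ i
cprev²-irreflexive zero          ()
cprev²-irreflexive (suc zero)    ()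
cprev²-irreflexive (suc (suc i)) eq = n≢2+n (begin
  toℕ i                       ≡⟨ sym (toℕ-inject₁ i) ⟩
  toℕ (inject₁ i)             ≡⟨ sym (toℕ-inject₁ (inject₁ i)) ⟩
  toℕ (inject₁ (inject₁ i))   ≡⟨ cong toℕ eq ⟩
  suc (suc (toℕ i))           ∎)
  where
  open ≡-Reasoning
  n≢2+n : ∀ {n} → n ≢ suc (suc n)
  n≢2+n ()

module _ {N : ℕ} {H : Hypergraph N} (convex : ∀ {S} → IsEdge H S → OrderConvex S)
         (C : BetaCycle H) where
  open BetaCycle C

  no-leftmost-node : ∀ p → ¬ (∀ j → toℕ (x p) ≤ toℕ (x j))
  no-leftmost-node p leftmost with cprev-surjective p
  ... | b , refl with ≤-total (toℕ (x (cprev p))) (toℕ (x b))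
  ...   | inj₁ xa≤xb =
    [ cprev-irreflexive p ∘ sym , cprev²-irreflexive p ∘ sym ]
      (only a p (convex (edge p) (leftmost a) xa≤xb (in-cur p) (in-prev b)))
    where
    a : Fin (suc (suc (suc k')))
    a = cprev p
  ...   | inj₂ xb≤xa =
    [ cprev²-irreflexive b , cprev-irreflexive p ]
      (only b a (convex (edge a) (leftmost b) xb≤xa (in-prev p) (in-cur a)))
    where
    a : Fin (suc (suc (suc k')))
    a = cprev p

orderConvex⇒betaAcyclic : ∀ {N} (H : Hypergraph N) →
  (∀ {S} → IsEdge H S → OrderConvex S) → BetaAcyclic H
orderConvex⇒betaAcyclic H convex C =
  let p , leftmost = ∃-argmin (toℕ ∘ BetaCycle.x C)
  in no-leftmost-node convex C p leftmost

proposition6p21 : (m : ℕ) (F : Fin (suc m) → Fin (suc m) → Set) →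
    (∀ u v → F u v → u ≢ v × ¬ Adjacent u v) →
    BetaAcyclic (pathHypergraph m F)
proposition6p21 m F _ = orderConvex⇒betaAcyclic (pathHypergraph m F) pathEdge-orderConvex
  where
  pathEdge-orderConvex : ∀ {S} → IsEdge (pathHypergraph m F) S → OrderConvex S
  pathEdge-orderConvex (u , v , _ , refl) = pathEdges-orderConvex u v
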